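{- Let $\ell\ge4$ be an integer, $f$ a slow function and $G$ the $(f,\ell)$-layered wheel with layers $L_1,L_2,\dots$. If $X\subseteq V(G)$ is a finite set containing at most one vertex of each layer, then $G[X]$ is chordal.
   Context: A graph is chordal if it has no hole (chordless cycle of length at least 4). A function $f:\mathbb N\setminus\{0\}\to\mathbb N\setminus\{0\}$ is slow if $f(1)=1,f(2)=2,f(3)=3$ and $f(i)\le f(i+1)\le f(i)+1$ for all $i$. The $(f,\ell)$-layered wheel $G$ is the infinite graph (considered as an undirected simple graph; orientations only descriptive) whose vertex set is partitioned into finite layers $L_1,L_2,\dots$, built inductively. For $v\in L_i$ let $N^\uparrow(v)$ be the set of neighbours of $v$ in $L_1\cup\dots\cup L_{i-1}$ and $N^\uparrow[v]=N^\uparrow(v)\cup\{v\}$. $L_1$ induces a directed cycle of length $\ell$. Given $L_1,\dots,L_i$, for each $v\in L_i$ create a directed path $L(v)=v_1\dots v_{n_v}$ of new vertices: (a) if $|N^\uparrow(v)|<f(i+1)-1$, then $n_v=\ell-2$, $N^\uparrow(v_1)=N^\uparrow[v]$ and $N^\uparrow(v_j)=\emptyset$ for $j\ge2$; (b) if $|N^\uparrow(v)|=f(i+1)-1=:m$, write $N^\uparrow(v)=\{w_1,\dots,w_m\}$; then $n_v=m(\ell-2)$, $N^\uparrow(v_{(j-1)(\ell-2)+1})=N^\uparrow[v]\setminus\{w_j\}$ for $j=1,\dots,m$, and all other vertices of $L(v)$ have $N^\uparrow=\emptyset$ (the construction guarantees $|N^\uparrow(v)|\le f(i+1)-1$ always).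 Specifying $N^\uparrow(u)$ for a new vertex $u$ means $u$ is adjacent exactly to those vertices of earlier layers. $L_{i+1}=\bigcup_{v\in L_i}V(L(v))$ induces the directed cycle obtained from the paths $L(v)$ by adding, for every arc $vv'$ of the cycle $L_i$, the arc $v_{n_v}v'_1$. -}

module Defs where

open import Data.Nat using (ℕ; zero; suc; _+_; _*_; _∸_; _≤_; _<_; _≤ᵇ_; _<ᵇ_; _≡ᵇ_)
open import Data.Bool using (Bool; true; false; if_then_else_)
open import Data.Fin using (Fin; zero; suc; toℕ)
open import Data.List using (List; []; _∷_; length; removeAt)
open import Data.List.Membership.Propositional using (_∈_)
open import Data.Maybe using (Maybe; just; nothing)
import Data.Maybe as Maybe
open import Data.Product using (Σ; _×_; _,_)
open import Data.Sum using (_⊎_)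
open import Data.Empty using (⊥)
open import Relation.Binary.PropositionalEquality using (_≡_; _≢_)
open import Relation.Nullary using (¬_)
open import Function.Definitions using (Injective)

-- Slow function.  The paper's f : ℕ∖{0} → ℕ∖{0}; we use f : ℕ → ℕ and
-- ignore the value f 0 (all constraints are on positive arguments;
-- positivity of values follows from the constraints).
record Slow (f : ℕ → ℕ) : Set where
  field
    f1 : f 1 ≡ 1
    f2 : f 2 ≡ 2
    f3 : f 3 ≡ 3
    step : ∀ i → 1 ≤ i → f i ≤ f (suc i) × f (suc i) ≤ suc (f i)

-- find d j m = just t  iff  t < m and j = t * d  (for d ≥ 1)
findIdx : (d j m : ℕ) → Maybe (Fin m)
findIdx d j zero = nothing
findIdx d j (suc m) =
  if j ≡ᵇ 0 then just zero
  else (if (1 ≤ᵇ d) Data.Bool.∧ (d ≤ᵇ j) then Maybe.map suc (findIdx d (j ∸ d) m) else nothing)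

-- Vertices are ADDRESSES: lists of naturals, most recent index first.
--   * the vertex (k ∷ []) with k < ℓ is the k-th vertex of the cycle L₁;
--   * if v is a vertex of L_i, then (j ∷ v) is the vertex v_{j+1} of the
--     path L(v) (0-based index j < n_v), a vertex of L_{i+1}.
-- The parameter π fixes the enumeration w₁,…,w_m of N↑(v) in case (b):
-- w_{t+1} is the element of the list upN v at position π v m t.
-- (The theorem is stated for every injective choice of π, i.e. every
-- enumeration.)
module LayeredWheel (f : ℕ → ℕ) (ℓ : ℕ) (π : List ℕ → (m : ℕ) → Fin m → Fin m) where

  -- N↑(v), as a list (duplicate-free by construction)
  -- N↑ of the child (j ∷ v) given p = v and up = N↑(v)
  upChild : ℕ → List ℕ → List (List ℕ) → List (List ℕ)
  upChild j p up =
    if length up <ᵇ f (suc (length p)) ∸ 1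
    then (if j ≡ᵇ 0 then p ∷ up else [])
    else upB (findIdx (ℓ ∸ 2) j (length up))
    where
      upB : Maybe (Fin (length up)) → List (List ℕ)
      upB nothing  = []
      upB (just t) = p ∷ removeAt up (π p (length up) t)

  upN : List ℕ → List (List ℕ)
  upN [] = []
  upN (k ∷ []) = []
  upN (j ∷ x ∷ v) = upChild j (x ∷ v) (upN (x ∷ v))

  -- n_v : number of vertices of the path L(v)
  nCh : List ℕ → ℕ
  nCh v = if length (upN v) <ᵇ f (suc (length v)) ∸ 1
          then ℓ ∸ 2
          else length (upN v) * (ℓ ∸ 2)

  Valid : List ℕ → Set
  Valid [] = ⊥
  Valid (k ∷ []) = k < ℓ
  Valid (j ∷ x ∷ v) = Valid (x ∷ v) × j < nCh (x ∷ v)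

  next : List ℕ → List ℕ
  next [] = []
  next (k ∷ []) = if suc k <ᵇ ℓ then suc k ∷ [] else 0 ∷ []
  next (j ∷ x ∷ v) = if suc j <ᵇ nCh (x ∷ v) then suc j ∷ x ∷ v else 0 ∷ next (x ∷ v)

  Adj : List ℕ → List ℕ → Set
  Adj u w = (u ∈ upN w) ⊎ (w ∈ upN u) ⊎ (next u ≡ w) ⊎ (next w ≡ u)

  layer : List ℕ → ℕ
  layer = length

CycSucc : {k : ℕ} → Fin k → Fin k → Set
CycSucc {k} i j = (suc (toℕ i) ≡ toℕ j) ⊎ (suc (toℕ i) ≡ k × toℕ j ≡ 0)

CycAdj : {k : ℕ} → Fin k → Fin k → Set
CycAdj i j = CycSucc i j ⊎ CycSucc j i

record Hole {V : Set} (Adj : V → V → Set) (X : List V) : Set where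
  field
    k      : ℕ
    k≥4    : 4 ≤ k
    c      : Fin k → V
    inj    : Injective _≡_ _≡_ c
    inX    : ∀ i → c i ∈ X
    cyc    : ∀ i j → CycAdj i j → Adj (c i) (c j)
    noChord : ∀ i j → Adj (c i) (c j) → CycAdj i j

Chordal : {V : Set} → (V → V → Set) → List V → Set
Chordal Adj X = ¬ Hole Adj X

-- The vertex of a hole lying in the deepest layer has both of its hole-neighbours
-- in earlier layers: a neighbour in the same layer would be a second vertex of X
-- in that layer, and one in a later layer would be deeper.  But the earlier
-- neighbours N↑(v) of any vertex v form a clique, since each is v's parent or
-- lies in N↑ of the parent.  So the two hole-neighbours are adjacent, a chord.
module Submission where

open import Defs
open import Data.Nat using (ℕ; zero; suc; _≤_; _<_; _∸_; _<ᵇ_; _≡ᵇ_; z≤n; s≤s)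
open import Data.Nat.Properties using (≤-refl; ≤-trans; m≤n⇒m≤1+n; <⇒≱)
open import Data.Fin using (Fin; zero; suc; fromℕ; fromℕ<; inject₁)
open import Data.Fin.Properties using (toℕ-fromℕ; toℕ-inject₁)
open import Data.List using (List; []; _∷_; length; removeAt; allFin)
open import Data.List.Extrema.Nat using (argmax; f[xs]≤f[argmax])
open import Data.List.Membership.Propositional using (_∈_)
open import Data.List.Membership.Propositional.Properties using (∈-allFin)
open import Data.List.Relation.Unary.All using (All)
import Data.List.Relation.Unary.All as All
open import Data.List.Relation.Unary.Any using (here; there)
open import Data.Bool using (true; false)
open import Data.Maybe using (just; nothing)
open import Data.Product using (∃-syntax; _×_; _,_; proj₁; proj₂)
open import Data.Sum using (_⊎_; inj₁; inj₂)
open import Data.Empty using (⊥-elim)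
open import Function using (_∘_)
open import Relation.Nullary using (¬_)
open import Relation.Binary.PropositionalEquality
  using (_≡_; _≢_; refl; sym; trans; cong; subst)
open import Function.Definitions using (Injective)

-- CycSucc {k} i j unfolds to SuccMod k (toℕ i) (toℕ j).
SuccMod : ℕ → ℕ → ℕ → Set
SuccMod k x y = (suc x ≡ y) ⊎ (suc x ≡ k × y ≡ 0)

succMod-irrefl : ∀ {k x} → 2 ≤ k → ¬ SuccMod k x x
succMod-irrefl _             (inj₁ ())
succMod-irrefl (s≤s (s≤s _)) (inj₂ (() , refl))

succMod-asym : ∀ {k x y} → 3 ≤ k → SuccMod k x y → ¬ SuccMod k y x
succMod-asym _                   (inj₁ refl)        (inj₁ ())
succMod-asym (s≤s (s≤s (s≤s _))) (inj₁ refl)        (inj₂ (() , refl))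
succMod-asym (s≤s (s≤s (s≤s _))) (inj₂ (() , refl)) (inj₁ refl)
succMod-asym (s≤s (s≤s (s≤s _))) (inj₂ (refl , refl)) (inj₂ (() , _))

succMod-twice⇒¬adjacent : ∀ {k x y z} → 4 ≤ k → SuccMod k x y → SuccMod k y z →
                           ¬ (SuccMod k x z ⊎ SuccMod k z x)
succMod-twice⇒¬adjacent _ (inj₁ refl) (inj₁ refl) (inj₁ (inj₁ ()))
succMod-twice⇒¬adjacent _ (inj₁ refl) (inj₁ refl) (inj₁ (inj₂ (_ , ())))
succMod-twice⇒¬adjacent _ (inj₁ refl) (inj₁ refl) (inj₂ (inj₁ ()))
succMod-twice⇒¬adjacent (s≤s (s≤s (s≤s (s≤s _)))) (inj₁ refl) (inj₁ refl) (inj₂ (inj₂ (() , refl)))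
succMod-twice⇒¬adjacent _ (inj₁ refl) (inj₂ (refl , refl)) (inj₁ (inj₁ ()))
succMod-twice⇒¬adjacent _ (inj₁ refl) (inj₂ (refl , refl)) (inj₁ (inj₂ (() , _)))
succMod-twice⇒¬adjacent (s≤s (s≤s (s≤s (s≤s _)))) (inj₁ refl) (inj₂ (refl , refl)) (inj₂ (inj₁ ()))
succMod-twice⇒¬adjacent _ (inj₁ refl) (inj₂ (refl , refl)) (inj₂ (inj₂ (() , _)))
succMod-twice⇒¬adjacent (s≤s (s≤s (s≤s (s≤s _)))) (inj₂ (refl , refl)) (inj₁ refl) (inj₁ (inj₁ ()))
succMod-twice⇒¬adjacent _ (inj₂ (refl , refl)) (inj₁ refl) (inj₁ (inj₂ (_ , ())))
succMod-twice⇒¬adjacent (s≤s (s≤s (s≤s (s≤s _)))) (inj₂ (refl , refl)) (inj₁ refl) (inj₂ (inj₁ ()))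
succMod-twice⇒¬adjacent (s≤s (s≤s (s≤s (s≤s _)))) (inj₂ (refl , refl)) (inj₂ (() , refl)) _

cycSucc : ∀ {k} (i : Fin k) → ∃[ j ] CycSucc i j
cycSucc {suc zero}    zero    = zero , inj₂ (refl , refl)
cycSucc {suc (suc _)} zero    = suc zero , inj₁ refl
cycSucc               (suc i) with cycSucc i
... | j , inj₁ i→j        = suc j , inj₁ (cong suc i→j)
... | _ , inj₂ (last , _) = zero , inj₂ (cong suc last , refl)

cycPred : ∀ {k} (i : Fin k) → ∃[ j ] CycSucc j i
cycPred {suc m} zero    = fromℕ m , inj₂ (cong suc (toℕ-fromℕ m) , refl)
cycPred         (suc j) = inject₁ j , inj₁ (cong suc (toℕ-inject₁ j))

LowerNeighboursAdjacent : {V : Set} → (V → V → Set) → (V → ℕ) → List V → Set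
LowerNeighboursAdjacent Adj rank X =
  ∀ {w u u′} → w ∈ X → u ∈ X → u′ ∈ X → u ≢ w → u′ ≢ w → u ≢ u′ →
  Adj w u → Adj w u′ → rank u ≤ rank w → rank u′ ≤ rank w → Adj u u′

lowerNeighboursAdjacent⇒chordal : {V : Set} {Adj : V → V → Set} (rank : V → ℕ) {X : List V} →
                                  LowerNeighboursAdjacent Adj rank X → Chordal Adj X
lowerNeighboursAdjacent⇒chordal {Adj = Adj} rank lower H =
  succMod-twice⇒¬adjacent k≥4 a→top top→b (noChord a b a~b)
  where
  open Hole H
  -- fromℕ< k≥4 is index 3; any index would do as the seed of the search.
  top : Fin k
  top = argmax (rank ∘ c) (fromℕ< k≥4) (allFin k)

  rank≤top : ∀ j → rank (c j) ≤ rank (c top)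
  rank≤top j = All.lookup (f[xs]≤f[argmax] {f = rank ∘ c} (fromℕ< k≥4) (allFin k)) (∈-allFin j)

  a b : Fin k
  a = proj₁ (cycPred top)
  b = proj₁ (cycSucc top)
  a→top : CycSucc a top
  a→top = proj₂ (cycPred top)
  top→b : CycSucc top b
  top→b = proj₂ (cycSucc top)

  2≤k : 2 ≤ k
  2≤k = ≤-trans (s≤s (s≤s z≤n)) k≥4
  3≤k : 3 ≤ k
  3≤k = ≤-trans (s≤s (s≤s (s≤s z≤n))) k≥4

  ca≢ctop : c a ≢ c top
  ca≢ctop e = succMod-irrefl 2≤k (subst (λ j → CycSucc j top) (inj e) a→top)
  cb≢ctop : c b ≢ c top
  cb≢ctop e = succMod-irrefl 2≤k (subst (CycSucc top) (inj e) top→b)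
  ca≢cb : c a ≢ c b
  ca≢cb e = succMod-asym 3≤k a→top (subst (CycSucc top) (sym (inj e)) top→b)

  a~b : Adj (c a) (c b)
  a~b = lower (inX top) (inX a) (inX b) ca≢ctop cb≢ctop ca≢cb
          (cyc top a (inj₂ a→top)) (cyc top b (inj₁ top→b)) (rank≤top a) (rank≤top b)

∈-removeAt⁻ : {A : Set} (xs : List A) (i : Fin (length xs)) {x : A} → x ∈ removeAt xs i → x ∈ xs
∈-removeAt⁻ (_ ∷ _)  zero    x∈      = there x∈
∈-removeAt⁻ (_ ∷ _)  (suc i) (here e)  = here e
∈-removeAt⁻ (_ ∷ ys) (suc i) (there x∈) = there (∈-removeAt⁻ ys i x∈)

module _ (f : ℕ → ℕ) (ℓ : ℕ) (π : List ℕ → (m : ℕ) → Fin m → Fin m) where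
  open LayeredWheel f ℓ π

  ∈-upChild⁻ : ∀ j p up {x} → x ∈ upChild j p up → x ≡ p ⊎ x ∈ up
  ∈-upChild⁻ j p up x∈ with length up <ᵇ f (suc (length p)) ∸ 1
  ∈-upChild⁻ j p up x∈ | true with j ≡ᵇ 0
  ∈-upChild⁻ j p up (here e)   | true | true  = inj₁ e
  ∈-upChild⁻ j p up (there x∈) | true | true  = inj₂ x∈
  ∈-upChild⁻ j p up ()         | true | false
  ∈-upChild⁻ j p up x∈ | false with findIdx (ℓ ∸ 2) j (length up)
  ∈-upChild⁻ j p up ()         | false | nothing
  ∈-upChild⁻ j p up (here e)   | false | just t = inj₁ e
  ∈-upChild⁻ j p up (there x∈) | false | just t = inj₂ (∈-removeAt⁻ up (π p (length up) t) x∈)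

  ∈-upN-∷⁻ : ∀ j p {x} → x ∈ upN (j ∷ p) → x ≡ p ⊎ x ∈ upN p
  ∈-upN-∷⁻ j []      ()
  ∈-upN-∷⁻ j (y ∷ v) = ∈-upChild⁻ j (y ∷ v) (upN (y ∷ v))

  ∈-upN⇒layer< : ∀ w {x} → x ∈ upN w → layer x < layer w
  ∈-upN⇒layer< []      ()
  ∈-upN⇒layer< (j ∷ p) x∈ with ∈-upN-∷⁻ j p x∈
  ... | inj₁ refl = ≤-refl
  ... | inj₂ x∈′  = m≤n⇒m≤1+n (∈-upN⇒layer< p x∈′)

  upN-clique : ∀ w {x y} → x ∈ upN w → y ∈ upN w → x ≢ y → x ∈ upN y ⊎ y ∈ upN x
  upN-clique []      ()
  upN-clique (j ∷ p) x∈ y∈ x≢y with ∈-upN-∷⁻ j p x∈ | ∈-upN-∷⁻ j p y∈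
  ... | inj₁ refl | inj₁ refl = ⊥-elim (x≢y refl)
  ... | inj₁ refl | inj₂ y∈′  = inj₂ y∈′
  ... | inj₂ x∈′  | inj₁ refl = inj₁ x∈′
  ... | inj₂ x∈′  | inj₂ y∈′  = upN-clique p x∈′ y∈′ x≢y

  layer-next : ∀ u → layer (next u) ≡ layer u
  layer-next []          = refl
  layer-next (k ∷ [])    with suc k <ᵇ ℓ
  ... | true  = refl
  ... | false = refl
  layer-next (j ∷ x ∷ v) with suc j <ᵇ nCh (x ∷ v) | layer-next (x ∷ v)
  ... | true  | _          = refl
  ... | false | layer-next = cong suc layer-next

  OnePerLayer : List (List ℕ) → Set
  OnePerLayer X = ∀ x y → x ∈ X → y ∈ X → layer x ≡ layer y → x ≡ y

  adjacent-lower⇒∈-upN : ∀ {X w u} → OnePerLayer X → w ∈ X → u ∈ X → u ≢ w →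
                         Adj w u → layer u ≤ layer w → u ∈ upN w
  adjacent-lower⇒∈-upN {u = u} _ _ _ _ (inj₁ w∈) u≤w = ⊥-elim (<⇒≱ (∈-upN⇒layer< u w∈) u≤w)
  adjacent-lower⇒∈-upN _ _ _ _ (inj₂ (inj₁ u∈)) _ = u∈
  adjacent-lower⇒∈-upN {w = w} one w∈X u∈X u≢w (inj₂ (inj₂ (inj₁ next-w))) _ =
    ⊥-elim (u≢w (one _ _ u∈X w∈X (trans (cong layer (sym next-w)) (layer-next w))))
  adjacent-lower⇒∈-upN {u = u} one w∈X u∈X u≢w (inj₂ (inj₂ (inj₂ next-u))) _ =
    ⊥-elim (u≢w (one _ _ u∈X w∈X (trans (sym (layer-next u)) (cong layer next-u))))

  onePerLayer⇒lowerNeighboursAdjacent : ∀ {X} → OnePerLayer X → LowerNeighboursAdjacent Adj layer X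
  onePerLayer⇒lowerNeighboursAdjacent one {w} w∈X u∈X u′∈X u≢w u′≢w u≢u′ w~u w~u′ u≤w u′≤w
    with upN-clique w (adjacent-lower⇒∈-upN one w∈X u∈X u≢w w~u u≤w)
                      (adjacent-lower⇒∈-upN one w∈X u′∈X u′≢w w~u′ u′≤w) u≢u′
  ... | inj₁ u∈ = inj₁ u∈
  ... | inj₂ u′∈ = inj₂ (inj₁ u′∈)

mainTheorem10 : (ℓ : ℕ) → 4 ≤ ℓ → (f : ℕ → ℕ) → Slow f →
    (π : List ℕ → (m : ℕ) → Fin m → Fin m) → (∀ v m → Injective _≡_ _≡_ (π v m)) →
    (X : List (List ℕ)) → All (LayeredWheel.Valid f ℓ π) X →
    (∀ x y → x ∈ X → y ∈ X → LayeredWheel.layer f ℓ π x ≡ LayeredWheel.layer f ℓ π y → x ≡ y) →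
    Chordal (LayeredWheel.Adj f ℓ π) X
mainTheorem10 ℓ _ f _ π _ X _ onePerLayer =
  lowerNeighboursAdjacent⇒chordal length (onePerLayer⇒lowerNeighboursAdjacent f ℓ π onePerLayer)
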